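{- Let $G=(V,A)$ be a flow graph with start vertex $s$, let $T$ be a rooted tree with the parent property, and let $<$ be a preorder of $T$ that is low-high on $G$. For each vertex $v\neq s$ choose vertices $b(v),r(v)$ by applying exactly one of the following cases that applies (if Cases 1 and 2 both apply, either may be used): Case 1: there are arcs $(u,v),(w,v)\in A$ with $u<v<w$ and $w$ not a descendant of $v$ in $T$; choose two such arcs and set $b(v)=u$, $r(v)=w$. Case 2: $(t(v),v)\in A$ and there is another arc $(u,v)\in A$ with $u<v$; choose such an arc and set $b(v)=u$, $r(v)=t(v)$. Case 3: $(t(v),v)$ is the only arc entering $v$ from a non-descendant of $v$ in $T$; set $b(v)=r(v)=t(v)$. Let $B$ be the subgraph with vertex set $V$ and arcs $\{(b(v),v): v\neq s\}$ and $R$ the subgraph with vertex set $V$ and arcs $\{(r(v),v): v\neq s\}$. Then $B$ and $R$ are strongly independent spanning trees of $G$ rooted at $s$.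
   Context: A flow graph is a finite directed graph $G=(V,A)$ with a designated start vertex $s$ such that every vertex is reachable from $s$; throughout, there are no arcs entering $s$ and $|V|>1$. A vertex $v$ dominates $w$ if every path from $s$ to $w$ contains $v$. For a rooted tree $T$, $t(v)$ denotes the parent of $v$; ancestors and descendants include the vertex itself. $T$ has the parent property if for every arc $(v,w)\in A$, $t(w)$ is an ancestor of $v$ in $T$. A preorder of $T$ is a total order of its vertices such that for every vertex $v$, the descendants of $v$ are ordered consecutively with $v$ first. A preorder of $T$ is low-high on $G$ if for every $v\neq s$, either $(t(v),v)\in A$, or there are two arcs $(u,v),(w,v)\in A$ with $u<v<w$ and $w$ not a descendant of $v$ in $T$. For a spanning tree $B$ rooted at $s$, $B[s,v]$ denotes the path in $B$ from $s$ to $v$. Two spanning trees $B$, $R$ rooted at $s$ are strongly independent if for every pair of vertices $v,w$, either $B[s,v]$ and $R[s,w]$ share only vertices that dominate both $v$ and $w$, or $R[s,v]$ and $B[s,w]$ share only vertices that dominate both $v$ and $w$. -}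

module Defs where

open import Data.Nat using (ℕ; _<_; _≤_)
open import Data.Fin using (Fin)
open import Data.Product using (Σ; _×_; ∃; ∃-syntax)
open import Data.Sum using (_⊎_)
open import Relation.Nullary using (¬_)
open import Relation.Binary.PropositionalEquality using (_≡_; _≢_)

Graph : ℕ → Set₁
Graph n = Fin n → Fin n → Set

-- Paths in G from u to w (walks; vertices may repeat, which does not
-- affect domination).
data Path {n : ℕ} (G : Graph n) (u : Fin n) : Fin n → Set where
  [] : Path G u u
  _▷_ : ∀ {v w} → Path G u v → G v w → Path G u w

data _∈P_ {n : ℕ} {G : Graph n} {u : Fin n} (x : Fin n) : ∀ {w} → Path G u w → Set where
  here-start : x ≡ u → x ∈P []
  here-end   : ∀ {v w} (p : Path G u v) (a : G v w) → x ≡ w → x ∈P (p ▷ a)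
  there      : ∀ {v w} (p : Path G u v) (a : G v w) → x ∈P p → x ∈P (p ▷ a)

record FlowGraph {n : ℕ} (G : Graph n) (s : Fin n) : Set where
  field
    reachable  : ∀ v → Path G s v
    no-into-s  : ∀ u → ¬ G u s
    two-vertices : 2 ≤ n

Dominates : ∀ {n} → Graph n → Fin n → Fin n → Fin n → Set
Dominates G s x w = (P : Path G s w) → x ∈P P

-- Rooted trees on Fin n with root s are given by a parent function p
-- (value at s irrelevant).  Anc p s x w : x is an ancestor of w
-- (reflexive), i.e. x occurs on the parent chain from w to s.
data Anc {n : ℕ} (p : Fin n → Fin n) (s : Fin n) (x : Fin n) : Fin n → Set where
  anc-refl : Anc p s x x
  anc-step : ∀ {w} → w ≢ s → Anc p s x (p w) → Anc p s x w

-- p is a rooted tree with root s spanning Fin n: from every vertex the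
-- parent chain reaches s (hence no cycles).
IsRootedTree : ∀ {n} → Fin n → (Fin n → Fin n) → Set
IsRootedTree s p = ∀ v → Anc p s s v

IsSpanningTree : ∀ {n} → Graph n → Fin n → (Fin n → Fin n) → Set
IsSpanningTree G s p = IsRootedTree s p × (∀ v → v ≢ s → G (p v) v)

ParentProperty : ∀ {n} → Graph n → Fin n → (Fin n → Fin n) → Set
ParentProperty G s t = ∀ v w → G v w → Anc t s (t w) v

-- A total order on Fin n is represented by an injective position map;
-- u < v iff pos u < pos v.
Injective : ∀ {n} → (Fin n → ℕ) → Set
Injective pos = ∀ u v → pos u ≡ pos v → u ≡ v

-- preorder of T: descendants of every v are consecutive with v first
IsPreorder : ∀ {n} → Fin n → (Fin n → Fin n) → (Fin n → ℕ) → Set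
IsPreorder s t pos =
  Injective pos ×
  (∀ v w → Anc t s v w → pos v ≤ pos w) ×
  (∀ v w x → Anc t s v w → pos v ≤ pos x → pos x ≤ pos w → Anc t s v x)

IsLowHigh : ∀ {n} → Graph n → Fin n → (Fin n → Fin n) → (Fin n → ℕ) → Set
IsLowHigh G s t pos = ∀ v → v ≢ s →
  G (t v) v ⊎
  (∃[ u ] ∃[ w ] (G u v × G w v × pos u < pos v × pos v < pos w × ¬ Anc t s v w))

Case1 : ∀ {n} → Graph n → Fin n → (Fin n → Fin n) → (Fin n → ℕ) → Fin n → Fin n → Fin n → Set
Case1 G s t pos v x y =
  G x v × G y v × pos x < pos v × pos v < pos y × ¬ Anc t s v y

Case2 : ∀ {n} → Graph n → Fin n → (Fin n → Fin n) → (Fin n → ℕ) → Fin n → Fin n → Fin n → Set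
Case2 G s t pos v x y =
  G (t v) v × G x v × x ≢ t v × pos x < pos v × y ≡ t v

Case3 : ∀ {n} → Graph n → Fin n → (Fin n → Fin n) → Fin n → Fin n → Fin n → Set
Case3 G s t v x y =
  G (t v) v × (∀ u → G u v → ¬ Anc t s v u → u ≡ t v) × x ≡ t v × y ≡ t v

ValidChoice : ∀ {n} → Graph n → Fin n → (Fin n → Fin n) → (Fin n → ℕ) →
              (Fin n → Fin n) → (Fin n → Fin n) → Set
ValidChoice G s t pos b r = ∀ v → v ≢ s →
  Case1 G s t pos v (b v) (r v) ⊎ Case2 G s t pos v (b v) (r v) ⊎ Case3 G s t v (b v) (r v)

-- paths B[s,v], R[s,w] share only vertices dominating both v and w
ShareOnlyDom : ∀ {n} → Graph n → Fin n → (Fin n → Fin n) → (Fin n → Fin n) → Fin n → Fin n → Set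
ShareOnlyDom G s p q v w =
  ∀ x → Anc p s x v → Anc q s x w → Dominates G s x v × Dominates G s x w

StronglyIndependent : ∀ {n} → Graph n → Fin n → (Fin n → Fin n) → (Fin n → Fin n) → Set
StronglyIndependent G s b r = ∀ v w →
  ShareOnlyDom G s b r v w ⊎ ShareOnlyDom G s r b v w

module Submission where

-- Every choice b(v), r(v) of Cases 1-3 satisfies:
--   * b(v) precedes v, so B-ancestors of v precede v and the B-chain of
--     every vertex descends in pos until it reaches s;
--   * r(v) is either t(v) or lies to the right of v (after v and not a
--     descendant of v).  Hence every R-ancestor of w is a T-ancestor of w
--     or lies to the right of w, and the R-chain terminates because the
--     pair (number of vertices right of v, pos v) decreases
--     lexicographically along it.
-- Strong independence: if pos v ≤ pos w, a common vertex x of B[s,v] and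
-- R[s,w] satisfies pos x ≤ pos v ≤ pos w, so x cannot lie right of w; it
-- is a T-ancestor of w, hence (preorder intervals) of v, and T-ancestors
-- dominate by the parent property.  The case pos w < pos v is symmetric.

open import Defs
open import Data.Nat using (ℕ; _<_; _≤_; _≤?_; _<?_)
open import Data.Nat.Properties
  using (≤-refl; ≤-trans; <-trans; <⇒≤; <-irrefl; <-≤-trans; ≰⇒>; m≤n⇒m<n∨m≡n)
open import Data.Nat.Induction using (<-wellFounded)
open import Data.Fin using (Fin) renaming (_≟_ to _≟F_)
open import Data.Fin.Subset using (Subset; _∈_; ∣_∣)
open import Data.Fin.Subset.Properties using (p⊆q⇒∣p∣≤∣q∣; p⊂q⇒∣p∣<∣q∣)
open import Data.Vec using (tabulate)
open import Data.Vec.Properties using (lookup∘tabulate; []=⇒lookup; lookup⇒[]=)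
open import Data.Product using (_×_; _,_; proj₁; proj₂; swap)
open import Data.Product.Relation.Binary.Lex.Strict using (×-Lex; ×-wellFounded)
open import Data.Sum using (_⊎_; inj₁; inj₂)
open import Data.Bool using (true; false)
open import Data.Empty using (⊥; ⊥-elim)
open import Level using (Level)
open import Relation.Binary using (Rel)
open import Relation.Binary.PropositionalEquality
open import Relation.Binary.Construct.On as On using ()
open import Relation.Nullary using (¬_; Dec; yes; no; does)
open import Relation.Nullary.Decidable using (dec-true; dec-false; decidable-stable)
open import Induction.WellFounded using (WellFounded; Acc; acc)

module _ {n : ℕ} {p : Fin n → Fin n} {s : Fin n} where

  anc-trans : ∀ {x y z} → Anc p s x y → Anc p s y z → Anc p s x z
  anc-trans x≼y anc-refl = x≼y
  anc-trans x≼y (anc-step z≢s x≼pz) = anc-step z≢s (anc-trans x≼y x≼pz)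

  rooted-no-fixpoint : IsRootedTree s p → ∀ {v} → v ≢ s → p v ≢ v
  rooted-no-fixpoint rooted {v} v≢s pv≡v = unreachable (rooted v) refl
    where
      -- the parent chain starting at a fixed point v never leaves v
      unreachable : ∀ {y} → Anc p s s y → y ≢ v
      unreachable anc-refl s≡v = v≢s (sym s≡v)
      unreachable (anc-step _ s≼py) y≡v = unreachable s≼py (trans (cong p y≡v) pv≡v)

  rooted-by-descent : ∀ {ℓ : Level} {_≺_ : Rel (Fin n) ℓ} → WellFounded _≺_ →
                      (∀ v → v ≢ s → p v ≺ v) → IsRootedTree s p
  rooted-by-descent {_≺_ = _≺_} wf descends v = chain v (wf v)
    where
      chain : ∀ v → Acc _≺_ v → Anc p s s v
      chain v (acc rec) with v ≟F s
      ... | yes refl = anc-refl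
      ... | no v≢s = anc-step v≢s (chain (p v) (rec (descends v v≢s)))

  anc? : IsRootedTree s p → ∀ x v → Dec (Anc p s x v)
  anc? rooted x v = along (rooted v)
    where
      along : ∀ {v} → Anc p s s v → Dec (Anc p s x v)
      along anc-refl with x ≟F s
      ... | yes refl = yes anc-refl
      ... | no x≢s = no λ { anc-refl → x≢s refl ; (anc-step s≢s _) → s≢s refl }
      along (anc-step {u} u≢s s≼pu) with x ≟F u
      ... | yes refl = yes anc-refl
      ... | no x≢u with along s≼pu
      ...   | yes x≼pu = yes (anc-step u≢s x≼pu)
      ...   | no x⋠pu = no λ { anc-refl → x≢u refl ; (anc-step _ x≼pu) → x⋠pu x≼pu }

-- With the parent property, every ancestor of v in T lies on every path
-- from s to v: the last arc (u, v) of the path has t v as an ancestor of u.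
ancestor-dominates : ∀ {n} {G : Graph n} {s : Fin n} {t : Fin n → Fin n} →
                     ParentProperty G s t → ∀ {x v} → Anc t s x v → Dominates G s x v
ancestor-dominates pp anc-refl [] = here-start refl
ancestor-dominates pp (anc-step s≢s _) [] = ⊥-elim (s≢s refl)
ancestor-dominates pp anc-refl (P ▷ a) = here-end P a refl
ancestor-dominates pp (anc-step _ x≼tv) (_▷_ {u} {v} P a) =
  there P a (ancestor-dominates pp (anc-trans x≼tv (pp u v a)) P)

module Preorder {n : ℕ} {s : Fin n} {t : Fin n → Fin n} {pos : Fin n → ℕ}
                (rooted : IsRootedTree s t) (pre : IsPreorder s t pos) where

  pos-injective : Injective pos
  pos-injective = proj₁ pre

  anc⇒≤ : ∀ {x v} → Anc t s x v → pos x ≤ pos v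
  anc⇒≤ = proj₁ (proj₂ pre) _ _

  interval : ∀ {x v y} → Anc t s x v → pos x ≤ pos y → pos y ≤ pos v → Anc t s x y
  interval = proj₂ (proj₂ pre) _ _ _

  parent-before : ∀ {v} → v ≢ s → pos (t v) < pos v
  parent-before {v} v≢s with m≤n⇒m<n∨m≡n (anc⇒≤ (anc-step v≢s anc-refl))
  ... | inj₁ tv<v = tv<v
  ... | inj₂ tv≡v = ⊥-elim (rooted-no-fixpoint rooted v≢s (pos-injective _ _ tv≡v))

  RightOf : Fin n → Fin n → Set
  RightOf v x = pos v < pos x × ¬ Anc t s v x

  right-of? : ∀ v x → Dec (RightOf v x)
  right-of? v x with pos v <? pos x | anc? rooted v x
  ... | yes v<x | no v⋠x = yes (v<x , v⋠x)
  ... | yes _ | yes v≼x = no λ R → proj₂ R v≼x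
  ... | no v≮x | _ = no λ R → v≮x (proj₁ R)

  right-of-irrefl : ∀ {v} → ¬ RightOf v v
  right-of-irrefl (v<v , _) = <-irrefl refl v<v

  right-of-parent : ∀ {v x} → v ≢ s → RightOf (t v) x → RightOf v x
  right-of-parent {v} {x} v≢s (tv<x , tv⋠x) = v<x , λ v≼x → tv⋠x (anc-trans tv≼v v≼x)
    where
      tv≼v : Anc t s (t v) v
      tv≼v = anc-step v≢s anc-refl

      -- x ≤ v would put x inside the interval of t v
      v<x : pos v < pos x
      v<x with pos x ≤? pos v
      ... | yes x≤v = ⊥-elim (tv⋠x (interval tv≼v (<⇒≤ tv<x) x≤v))
      ... | no x≰v = ≰⇒> x≰v

  right-of-trans : ∀ {v y x} → RightOf v y → RightOf y x → RightOf v x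
  right-of-trans (v<y , v⋠y) (y<x , _) =
    <-trans v<y y<x , λ v≼x → v⋠y (interval v≼x (<⇒≤ v<y) (<⇒≤ y<x))

  right-of-ancestor : ∀ {v y x} → RightOf v y → Anc t s x y → Anc t s x v ⊎ RightOf v x
  right-of-ancestor {v} {y} {x} (v<y , v⋠y) x≼y with pos x ≤? pos v
  ... | yes x≤v = inj₁ (interval x≼y x≤v (<⇒≤ v<y))
  ... | no x≰v = inj₂ (≰⇒> x≰v , λ v≼x → v⋠y (anc-trans v≼x x≼y))

  right-set : Fin n → Subset n
  right-set v = tabulate (λ x → does (right-of? v x))

  ∈-right-set : ∀ {v x} → RightOf v x → x ∈ right-set v
  ∈-right-set {v} {x} R =
    lookup⇒[]= x _ (trans (lookup∘tabulate _ x) (dec-true (right-of? v x) R))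

  right-set-∈ : ∀ {v x} → x ∈ right-set v → RightOf v x
  right-set-∈ {v} {x} x∈ = decidable-stable (right-of? v x) λ ¬R →
    true≢false (trans (sym ([]=⇒lookup x∈))
                      (trans (lookup∘tabulate _ x) (dec-false (right-of? v x) ¬R)))
    where
      true≢false : true ≡ false → ⊥
      true≢false ()

  ∣right-set∣-parent : ∀ {v} → v ≢ s → ∣ right-set (t v) ∣ ≤ ∣ right-set v ∣
  ∣right-set∣-parent v≢s =
    p⊆q⇒∣p∣≤∣q∣ λ x∈ → ∈-right-set (right-of-parent v≢s (right-set-∈ x∈))

  -- moving right strictly shrinks it: y itself is lost
  ∣right-set∣-right : ∀ {v y} → RightOf v y → ∣ right-set y ∣ < ∣ right-set v ∣
  ∣right-set∣-right {v} {y} v⊏y = p⊂q⇒∣p∣<∣q∣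
    ( (λ x∈ → ∈-right-set (right-of-trans v⊏y (right-set-∈ x∈)))
    , y , ∈-right-set v⊏y , λ y∈ → right-of-irrefl (right-set-∈ y∈))

module Choice {n : ℕ} {G : Graph n} {s : Fin n} {t : Fin n → Fin n} {pos : Fin n → ℕ}
              {b r : Fin n → Fin n}
              (rooted : IsRootedTree s t) (pp : ParentProperty G s t)
              (pre : IsPreorder s t pos) (choice : ValidChoice G s t pos b r) where

  open Preorder rooted pre

  b-arc : ∀ v → v ≢ s → G (b v) v
  b-arc v v≢s with choice v v≢s
  ... | inj₁ (bv→v , _) = bv→v
  ... | inj₂ (inj₁ (_ , bv→v , _)) = bv→v
  ... | inj₂ (inj₂ (tv→v , _ , bv≡tv , _)) = subst (λ x → G x v) (sym bv≡tv) tv→v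

  r-arc : ∀ v → v ≢ s → G (r v) v
  r-arc v v≢s with choice v v≢s
  ... | inj₁ (_ , rv→v , _) = rv→v
  ... | inj₂ (inj₁ (tv→v , _ , _ , _ , rv≡tv)) = subst (λ x → G x v) (sym rv≡tv) tv→v
  ... | inj₂ (inj₂ (tv→v , _ , _ , rv≡tv)) = subst (λ x → G x v) (sym rv≡tv) tv→v

  b-before : ∀ {v} → v ≢ s → pos (b v) < pos v
  b-before {v} v≢s with choice v v≢s
  ... | inj₁ (_ , _ , bv<v , _) = bv<v
  ... | inj₂ (inj₁ (_ , _ , _ , bv<v , _)) = bv<v
  ... | inj₂ (inj₂ (_ , _ , bv≡tv , _)) =
    subst (λ x → pos x < pos v) (sym bv≡tv) (parent-before v≢s)

  r-step : ∀ {v} → v ≢ s → RightOf v (r v) ⊎ r v ≡ t v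
  r-step {v} v≢s with choice v v≢s
  ... | inj₁ (_ , _ , _ , v<rv , v⋠rv) = inj₁ (v<rv , v⋠rv)
  ... | inj₂ (inj₁ (_ , _ , _ , _ , rv≡tv)) = inj₂ rv≡tv
  ... | inj₂ (inj₂ (_ , _ , _ , rv≡tv)) = inj₂ rv≡tv

  b-spanning : IsSpanningTree G s b
  b-spanning = rooted-by-descent (On.wellFounded pos <-wellFounded) (λ _ → b-before) , b-arc

  b-anc-before : ∀ {x v} → Anc b s x v → pos x ≤ pos v
  b-anc-before anc-refl = ≤-refl
  b-anc-before (anc-step v≢s x≼bv) = ≤-trans (b-anc-before x≼bv) (<⇒≤ (b-before v≢s))

  r-anc-shape : ∀ {x w} → Anc r s x w → Anc t s x w ⊎ RightOf w x
  r-anc-shape anc-refl = inj₁ anc-refl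
  r-anc-shape {x} {w} (anc-step w≢s x≼rw) with r-step w≢s | r-anc-shape x≼rw
  ... | inj₁ w⊏rw | inj₁ x≼rw′ = right-of-ancestor w⊏rw x≼rw′
  ... | inj₁ w⊏rw | inj₂ rw⊏x = inj₂ (right-of-trans w⊏rw rw⊏x)
  ... | inj₂ rw≡tw | inj₁ x≼rw′ = inj₁ (anc-step w≢s (subst (Anc t s x) rw≡tw x≼rw′))
  ... | inj₂ rw≡tw | inj₂ rw⊏x =
    inj₂ (right-of-parent w≢s (subst (λ y → RightOf y x) rw≡tw rw⊏x))

  r-measure : Fin n → ℕ × ℕ
  r-measure v = ∣ right-set v ∣ , pos v

  _≺_ : Rel (Fin n) _
  u ≺ v = ×-Lex _≡_ _<_ _<_ (r-measure u) (r-measure v)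

  -- the parent keeps at least as many vertices to its right and comes earlier
  parent-descends : ∀ {v} → v ≢ s → t v ≺ v
  parent-descends v≢s with m≤n⇒m<n∨m≡n (∣right-set∣-parent v≢s)
  ... | inj₁ fewer = inj₁ fewer
  ... | inj₂ same = inj₂ (same , parent-before v≢s)

  r-descends : ∀ v → v ≢ s → r v ≺ v
  r-descends v v≢s with r-step v≢s
  ... | inj₁ v⊏rv = inj₁ (∣right-set∣-right v⊏rv)
  ... | inj₂ rv≡tv = subst (_≺ v) (sym rv≡tv) (parent-descends v≢s)

  r-spanning : IsSpanningTree G s r
  r-spanning =
    rooted-by-descent (On.wellFounded r-measure (×-wellFounded <-wellFounded <-wellFounded))
                      r-descends
    , r-arc

  shared-dominates : ∀ {v w} → pos v ≤ pos w → ShareOnlyDom G s b r v w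
  shared-dominates {v} {w} v≤w x x≼ᴮv x≼ᴿw with r-anc-shape x≼ᴿw
  ... | inj₁ x≼w = ancestor-dominates pp (interval x≼w x≤v v≤w) , ancestor-dominates pp x≼w
    where
      x≤v : pos x ≤ pos v
      x≤v = b-anc-before x≼ᴮv
  ... | inj₂ (w<x , _) = ⊥-elim (<-irrefl refl (<-≤-trans w<x (≤-trans (b-anc-before x≼ᴮv) v≤w)))

  strongly-independent : StronglyIndependent G s b r
  strongly-independent v w with pos v ≤? pos w
  ... | yes v≤w = inj₁ (shared-dominates v≤w)
  ... | no v≰w = inj₂ λ x x≼ᴿv x≼ᴮw →
    swap (shared-dominates (<⇒≤ (≰⇒> v≰w)) x x≼ᴮw x≼ᴿv)

theorem8 : ∀ {n} (G : Graph n) (s : Fin n) (t : Fin n → Fin n) (pos : Fin n → ℕ)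
           (b r : Fin n → Fin n) →
           FlowGraph G s →
           IsRootedTree s t →
           ParentProperty G s t →
           IsPreorder s t pos →
           IsLowHigh G s t pos →
           ValidChoice G s t pos b r →
           IsSpanningTree G s b × IsSpanningTree G s r × StronglyIndependent G s b r
theorem8 G s t pos b r _ rooted pp pre _ choice =
  b-spanning , r-spanning , strongly-independent
  where open Choice rooted pp pre choice
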